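{- Let $w[1..n]$ be a string over a totally ordered alphabet $\Sigma$. If $w[1..m]$ is the shortest prefix of $w$ that is maximal right-closed (as an occurrence in $w$), then $w[1..m]=\lambda^m$ for some $\lambda\in\Sigma$, where $1\le m\le n$. Moreover, every prefix of $\lambda^m$ is closed.
   Context: Strings are indexed from 1; $w[i..j]$ denotes the substring (occurrence) of $w$ from position $i$ to position $j$. A border of a string $x$ is a nonempty string that is both a proper prefix and a proper suffix of $x$. A string $x$ is closed if $|x|=1$, or $|x|\ge 2$ and $x$ has a border that occurs in $x$ only as a prefix and as a suffix and nowhere else (equivalently, the longest border of $x$ has no internal occurrence in $x$); otherwise $x$ is open. An occurrence $w[i..j]$ is maximal right-closed if it is closed and either $j=n$ or $w[i..j+1]$ is not closed. -}

module Defs where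

open import Data.Nat using (ℕ; zero; suc; _+_; _≤_; _<_)
open import Data.List using (List; []; _∷_; _++_; length; take)
open import Data.Product using (Σ; ∃; ∃-syntax; _×_; _,_)
open import Data.Sum using (_⊎_)
open import Relation.Nullary using (¬_)
open import Relation.Binary.PropositionalEquality using (_≡_)

module _ {A : Set} where

  -- Strings over A are lists; positions are 1-based in the paper,
  -- here occurrences are described by 0-based offsets.

  OccursAt : List A → List A → ℕ → Set
  OccursAt b x i = ∃[ u ] ∃[ v ] (x ≡ u ++ b ++ v × length u ≡ i)

  Border : List A → List A → Set
  Border x b =
    1 ≤ length b × length b < length x ×
    (∃[ u ] x ≡ b ++ u) × (∃[ v ] x ≡ v ++ b)

  Closed : List A → Set
  Closed x =
    length x ≡ 1 ⊎
    (2 ≤ length x ×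
      ∃[ b ] (Border x b ×
        (∀ i → OccursAt b x i → i ≡ 0 ⊎ i + length b ≡ length x)))

  MaxRightClosedPrefix : List A → ℕ → Set
  MaxRightClosedPrefix w m =
    1 ≤ m × m ≤ length w × Closed (take m w) ×
    (m ≡ length w ⊎ ¬ Closed (take (suc m) w))

-- The first letter c of w is the only candidate for λ.  Every power c^k is
-- closed, its border c^(k-1) occurring only as prefix and suffix, while
-- c^k d with d ≠ c has no border at all, since a border would begin with c
-- and end with d.  So as long as the prefix of w is a power c^k, either the
-- next letter is c again or c^k is already maximal right-closed; minimality
-- of m rules out the latter for every k < m.
module Submission where

open import Defs
open import Level using (0ℓ)
open import Data.Nat using (ℕ; zero; suc; _+_; _≤_; _<_; z≤n; s≤s)
open import Data.Nat.Properties
  using (≤-refl; ≤-trans; <⇒≤; n≮n; <-≤-trans; ≤-pred; +-comm; +-monoʳ-≤; m≤m+n; m+n≤o⇒n≤o; module ≤-Reasoning)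
open import Data.List using (List; []; _∷_; _++_; _∷ʳ_; [_]; length; take; replicate; lookup)
open import Data.List.Properties using (∷-injective; length-++; length-replicate; ++-assoc; ∷ʳ-injectiveʳ; take-suc)
open import Data.Fin using (fromℕ<)
open import Data.Fin.Properties using (toℕ-fromℕ<)
open import Data.Product using (∃-syntax; _×_; _,_)
open import Data.Sum using (_⊎_; inj₁; inj₂)
open import Relation.Nullary using (¬_; yes; no; contradiction)
open import Relation.Binary.Core using (Rel)
open import Relation.Binary.Definitions using (DecidableEquality)
open import Relation.Binary.Structures using (IsStrictTotalOrder)
open import Relation.Binary.PropositionalEquality
  using (_≡_; _≢_; refl; sym; trans; cong; subst; module ≡-Reasoning)

module _ {A : Set} where

  occursAt-bound : ∀ {b x : List A} {i} → OccursAt b x i → i + length b ≤ length x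
  occursAt-bound {b} (u , v , refl , refl) = begin
    length u + length b                ≤⟨ +-monoʳ-≤ (length u) (m≤m+n (length b) (length v)) ⟩
    length u + (length b + length v)   ≡⟨ sym (trans (length-++ u) (cong (length u +_) (length-++ b))) ⟩
    length (u ++ b ++ v)               ∎
    where open ≤-Reasoning

  replicate-suc-∷ʳ : ∀ n (c : A) → replicate (suc n) c ≡ replicate n c ∷ʳ c
  replicate-suc-∷ʳ zero    c = refl
  replicate-suc-∷ʳ (suc n) c = cong (c ∷_) (replicate-suc-∷ʳ n c)

  length-replicate-∷ʳ : ∀ k (c d : A) → length (replicate k c ∷ʳ d) ≡ suc k
  length-replicate-∷ʳ k c d = begin
    length (replicate k c ∷ʳ d)   ≡⟨ length-++ (replicate k c) ⟩
    length (replicate k c) + 1    ≡⟨ cong (_+ 1) (length-replicate k) ⟩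
    k + 1                         ≡⟨ +-comm k 1 ⟩
    suc k                         ∎
    where open ≡-Reasoning

  replicate-closed : ∀ {k} {c : A} → 1 ≤ k → Closed (replicate k c)
  replicate-closed {suc zero}    _ = inj₁ refl
  replicate-closed {suc (suc n)} {c} _ =
    inj₂ (s≤s (s≤s z≤n) , replicate (suc n) c ,
          (s≤s z≤n , ≤-refl , ([ c ] , replicate-suc-∷ʳ (suc n) c) , ([ c ] , refl)) ,
          λ i occ → only-prefix-or-suffix i (occursAt-bound occ))
    where
    only-prefix-or-suffix : ∀ i → i + length (replicate (suc n) c) ≤ length (replicate (suc (suc n)) c) →
                            i ≡ 0 ⊎ i + length (replicate (suc n) c) ≡ length (replicate (suc (suc n)) c)
    only-prefix-or-suffix zero          _ = inj₁ refl
    only-prefix-or-suffix (suc zero)    _ = inj₂ refl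
    only-prefix-or-suffix (suc (suc j)) (s≤s (s≤s j+1+n≤n)) =
      contradiction (m+n≤o⇒n≤o j j+1+n≤n) (n≮n (length (replicate n c)))

  prefix-of-replicate : ∀ {k} {c : A} (b : List A) {u ys} →
                        b ++ u ≡ replicate k c ++ ys → length b ≤ k → b ≡ replicate (length b) c
  prefix-of-replicate []      _  _         = refl
  prefix-of-replicate {suc k} (x ∷ b) eq (s≤s |b|≤k) with ∷-injective eq
  ... | refl , eq′ = cong (x ∷_) (prefix-of-replicate b eq′ |b|≤k)

  replicate-∷ʳ-borderless : ∀ k {c d : A} → d ≢ c → ∀ b → ¬ Border (replicate k c ∷ʳ d) b
  replicate-∷ʳ-borderless k {c} {d} d≢c b (1≤|b| , |b|<|x| , (u , prefix) , (v , suffix))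
    with length b | prefix-of-replicate b (sym prefix) (≤-pred (subst (length b <_) (length-replicate-∷ʳ k c d) |b|<|x|))
  ... | suc ℓ | refl = d≢c (∷ʳ-injectiveʳ (replicate k c) (v ++ replicate ℓ c) (begin
    replicate k c ∷ʳ d              ≡⟨ suffix ⟩
    v ++ replicate (suc ℓ) c        ≡⟨ cong (v ++_) (replicate-suc-∷ʳ ℓ c) ⟩
    v ++ (replicate ℓ c ∷ʳ c)       ≡⟨ sym (++-assoc v (replicate ℓ c) [ c ]) ⟩
    (v ++ replicate ℓ c) ∷ʳ c       ∎))
    where open ≡-Reasoning

  replicate-∷ʳ-open : ∀ {k} {c d : A} → 1 ≤ k → d ≢ c → ¬ Closed (replicate k c ∷ʳ d)
  replicate-∷ʳ-open {suc k} {c} {d} _ _ (inj₁ |x|≡1) with trans (sym (length-replicate-∷ʳ (suc k) c d)) |x|≡1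
  ... | ()
  replicate-∷ʳ-open {suc k} _ d≢c (inj₂ (_ , b , border , _)) = replicate-∷ʳ-borderless (suc k) d≢c b border

  take-suc-∷ʳ : ∀ {k} (w : List A) (k<|w| : k < length w) →
                take (suc k) w ≡ take k w ∷ʳ lookup w (fromℕ< k<|w|)
  take-suc-∷ʳ w k<|w| =
    subst (λ j → take (suc j) w ≡ take j w ∷ʳ lookup w (fromℕ< k<|w|)) (toℕ-fromℕ< k<|w|) (take-suc w (fromℕ< k<|w|))

  power-prefix-extends : DecidableEquality A → ∀ {w : List A} {k c} →
                         take k w ≡ replicate k c → 1 ≤ k → k < length w → ¬ MaxRightClosedPrefix w k →
                         take (suc k) w ≡ replicate (suc k) c
  power-prefix-extends _≟_ {w} {k} {c} prefix 1≤k k<|w| not-maximal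
    with lookup w (fromℕ< k<|w|) ≟ c | take-suc-∷ʳ w k<|w|
  ... | yes refl | next = trans next (trans (cong (_∷ʳ c) prefix) (sym (replicate-suc-∷ʳ k c)))
  ... | no d≢c   | next = contradiction
    (1≤k , <⇒≤ k<|w| ,
     subst Closed (sym prefix) (replicate-closed 1≤k) ,
     inj₂ (λ closed → replicate-∷ʳ-open 1≤k d≢c (subst Closed (trans next (cong (_∷ʳ _) prefix)) closed)))
    not-maximal

lemma2 : (Σ : Set) (_<Σ_ : Rel Σ 0ℓ) → IsStrictTotalOrder _≡_ _<Σ_ →
    (w : List Σ) (m : ℕ) →
    MaxRightClosedPrefix w m →
    (∀ m′ → m′ < m → ¬ MaxRightClosedPrefix w m′) →
    ∃[ c ] (take m w ≡ replicate m c ×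
    (∀ k → 1 ≤ k → k ≤ m → Closed (replicate k c)))
lemma2 Σ _<Σ_ sto []      m (1≤m , m≤0 , _) _ = contradiction (≤-trans 1≤m m≤0) (n≮n 0)
lemma2 Σ _<Σ_ sto (c ∷ w) m (_ , m≤|w| , _) minimal =
  c , power-prefix m ≤-refl , λ k 1≤k _ → replicate-closed 1≤k
  where
  open IsStrictTotalOrder sto using (_≟_)
  power-prefix : ∀ k → k ≤ m → take k (c ∷ w) ≡ replicate k c
  power-prefix zero          _     = refl
  power-prefix (suc zero)    _     = refl
  power-prefix (suc (suc k)) k+2≤m =
    power-prefix-extends _≟_ (power-prefix (suc k) (<⇒≤ k+2≤m)) (s≤s z≤n)
      (<-≤-trans k+2≤m m≤|w|) (minimal (suc k) k+2≤m)
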